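{- Let $G$ be a graph and let $\tau$ be a 4-tangle in $G$. Then there is a minor-map $\varphi\colon G\succcurlyeq H$ such that $H$ is 3-connected and $\varphi(\tau)=\{\varphi(s):s\in\tau\}$ is a 4-tangle in $H$.
   Context: All graphs are finite and simple. A separation of $G$ is a set $\{A,B\}$ with $A\cup B=V(G)$ and no edge between $A\setminus B$ and $B\setminus A$; its order is $|A\cap B|$; its orientations are $(A,B),(B,A)$. A $k$-tangle in $G$ is a set $\tau$ of oriented separations of order $<k$ containing exactly one orientation of every separation of order $<k$, and no three (not necessarily distinct) elements $(A_1,B_1),(A_2,B_2),(A_3,B_3)$ with $G[A_1]\cup G[A_2]\cup G[A_3]=G$. A minor-map $\varphi\colon G\succcurlyeq H$ is a pair $(U,f)$, $U\subseteq V(G)$, $f\colon U\to V(H)$ surjective, with branch sets $f^{ -1}(x)$ inducing connected subgraphs and each edge $xy$ of $H$ realised by an edge of $G$ between $f^{ -1}(x)$ and $f^{ -1}(y)$. For oriented $(A,B)$, $\varphi(A,B):=(A_\varphi,B_\varphi)$ where $A_\varphi$ is the set of vertices of $H$ whose branch set meets $A$, similarly $B_\varphi$. -}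

module Defs where

open import Data.Nat using (ℕ; _<_)
open import Data.Bool using (Bool; true; false)
open import Data.Fin using (Fin)
open import Data.Fin.Subset using (Subset; _∈_; _∉_; _∩_; ∣_∣; ∁)
open import Data.Fin.Subset.Properties using (_∈?_)
open import Data.Fin.Properties using (any?)
open import Data.Fin.Properties as FinP using ()
open import Data.Maybe using (Maybe; just)
open import Data.Maybe.Properties using (≡-dec)
open import Data.Vec using (tabulate)
open import Data.Product using (Σ; ∃; ∃₂; _×_; _,_)
open import Data.Sum using (_⊎_)
open import Relation.Nullary using (¬_; Dec)
open import Relation.Nullary.Decidable using (⌊_⌋; _×-dec_)
open import Relation.Binary.PropositionalEquality using (_≡_)

record Graph : Set where
  field
    n     : ℕ
    E     : Fin n → Fin n → Bool
    E-sym : ∀ x y → E x y ≡ E y x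
    E-irr : ∀ x → E x x ≡ false

open Graph public

V : Graph → Set
V G = Fin (n G)

VSet : Graph → Set
VSet G = Subset (n G)

Adj : (G : Graph) → V G → V G → Set
Adj G x y = E G x y ≡ true

IsSep : (G : Graph) → VSet G → VSet G → Set
IsSep G A B =
  (∀ v → v ∈ A ⊎ v ∈ B) ×
  (∀ u v → u ∈ A → u ∉ B → v ∈ B → v ∉ A → ¬ Adj G u v)

order : (G : Graph) → VSet G → VSet G → ℕ
order G A B = ∣ A ∩ B ∣

Covers3 : (G : Graph) → VSet G → VSet G → VSet G → Set
Covers3 G A₁ A₂ A₃ =
  (∀ v → v ∈ A₁ ⊎ v ∈ A₂ ⊎ v ∈ A₃) ×
  (∀ u v → Adj G u v →
     (u ∈ A₁ × v ∈ A₁) ⊎ (u ∈ A₂ × v ∈ A₂) ⊎ (u ∈ A₃ × v ∈ A₃))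

OrientedSepSet : Graph → Set₁
OrientedSepSet G = VSet G → VSet G → Set

record IsTangle (G : Graph) (k : ℕ) (τ : OrientedSepSet G) : Set where
  field
    members   : ∀ A B → τ A B → IsSep G A B × order G A B < k
    total     : ∀ A B → IsSep G A B → order G A B < k → τ A B ⊎ τ B A
    exclusive : ∀ A B → τ A B → τ B A → A ≡ B
    no-cover  : ∀ A₁ B₁ A₂ B₂ A₃ B₃ → τ A₁ B₁ → τ A₂ B₂ → τ A₃ B₃ →
                ¬ Covers3 G A₁ A₂ A₃

data WalkIn (G : Graph) (S : VSet G) : V G → V G → Set where
  stop : ∀ {u} → u ∈ S → WalkIn G S u u
  step : ∀ {u w v} → u ∈ S → Adj G u w → WalkIn G S w v → WalkIn G S u v

ConnectedIn : (G : Graph) → VSet G → Set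
ConnectedIn G S = ∀ u v → u ∈ S → v ∈ S → WalkIn G S u v

KConnected : ℕ → Graph → Set
KConnected k G = k < n G × (∀ (X : VSet G) → ∣ X ∣ < k → ConnectedIn G (∁ X))

-- Minor-map φ = (U, f) : G ≽ H, with U = {u | f u ≠ nothing}
_≟M_ : ∀ {m} (a b : Maybe (Fin m)) → Dec (a ≡ b)
_≟M_ = ≡-dec FinP._≟_

record MinorMap (G H : Graph) : Set where
  field
    f : V G → Maybe (V H)
  branch : V H → VSet G
  branch x = tabulate (λ u → ⌊ f u ≟M just x ⌋)
  field
    surj        : ∀ x → ∃ λ u → f u ≡ just x
    branch-conn : ∀ x → ConnectedIn G (branch x)
    edges       : ∀ x y → Adj H x y →
                  ∃₂ λ u v → f u ≡ just x × f v ≡ just y × Adj G u v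

open MinorMap public

imgSet : ∀ {G H} → MinorMap G H → VSet G → VSet H
imgSet φ A = tabulate (λ x → ⌊ any? (λ u → (u ∈? A) ×-dec (f φ u ≟M just x)) ⌋)

imgτ : ∀ {G H} → MinorMap G H → OrientedSepSet G → OrientedSepSet H
imgτ φ τ C D = ∃₂ λ A B → τ A B × imgSet φ A ≡ C × imgSet φ B ≡ D

module Submission where

-- Induction on |G|. A 4-tangle forces |G| > 3, so if G is not 3-connected some
-- set X of at most two vertices separates two vertices u and v. For the components
-- C of u and of v in G − X, the separations (C ∪ N(C), V ∖ C) have order ≤ 2, and τ
-- cannot contain both reversed orientations (V ∖ C, C ∪ N(C)), since the complements
-- of the two components cover G. This yields a connected set R with |N(R)| ≤ 2 on the
-- small side of τ. Contracting R onto a vertex of N(R) gives a smaller minor H,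
-- namely G − R with N(R) made complete, and τ induces a 4-tangle on H: a separation
-- (C, D) of H pulls back to a separation of G of no larger order by putting R on
-- the side that contains N(R), and since N(R) is a clique in H, coverings of H pull
-- back to coverings of G.

open import Defs
open import Data.Bool using (true; false)
import Data.Bool as Bool
open import Data.Empty using (⊥; ⊥-elim)
open import Data.Fin using (Fin; zero; suc)
open import Data.Fin.Properties using (any?; all?; pigeonhole; <⇒≢)
  renaming (_≟_ to _≟ᶠ_)
open import Data.Fin.Subset using (Subset; _∈_; _∉_; _∩_; _∪_; ∣_∣; ∁; ⁅_⁆; ⊤)
open import Data.Fin.Subset.Properties
  using ( _∈?_; anySubset?; ⊆-antisym; ∈⊤; x∈⁅x⁆; x∈⁅y⁆⇒x≡y; ∣p∣≤n; ∣p∣≡n⇒p≡⊤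
        ; p⊆p∪q; q⊆p∪q; x∈p∪q⁻; x∈p∩q⁺; x∈p∩q⁻; p⊆q⇒∣p∣≤∣q∣; p⊂q⇒∣p∣<∣q∣
        ; x∉p⇒x∈∁p; x∈∁p⇒x∉p; x∉∁p⇒x∈p; ∣⊤∣≡n; ∣p∩q∣≤∣p∣ )
open import Data.Maybe using (Maybe; just; nothing; _>>=_)
open import Data.Maybe.Properties using (just-injective)
open import Data.Nat using (ℕ; zero; suc; _+_; _<_; _≤_; _<?_; _≤?_; s≤s)
import Data.Nat.Properties as ℕ
open import Data.Nat.Induction using (<-wellFounded)
open import Induction.WellFounded using (Acc; acc)
open import Data.Product using (Σ; ∃; ∃₂; _×_; _,_; proj₁; proj₂)
import Data.Product as Product
open import Data.Sum using (_⊎_; inj₁; inj₂; [_,_])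
import Data.Sum as Sum
open import Data.Vec using (_∷_; tabulate; here; there)
open import Data.Vec.Properties using (lookup∘tabulate; []=⇒lookup; lookup⇒[]=)
open import Function using (_∘_; id; _⇔_; mk⇔)
open import Relation.Nullary using (¬_; Dec; yes; no; ¬?)
open import Relation.Nullary.Decidable
  using (⌊_⌋; isYes≗does; dec-true; dec-false; does-⇔; toSum; _×-dec_; _⊎-dec_; _→-dec_)
open import Relation.Binary.PropositionalEquality
  using (_≡_; _≢_; refl; sym; trans; cong; subst; subst₂)

isYes⁻ : ∀ {P : Set} (P? : Dec P) → ⌊ P? ⌋ ≡ true → P
isYes⁻ (yes p) _ = p

isYes⁺ : ∀ {P : Set} (P? : Dec P) → P → ⌊ P? ⌋ ≡ true
isYes⁺ P? p = trans (isYes≗does P?) (dec-true P? p)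

isYes-false : ∀ {P : Set} (P? : Dec P) → ¬ P → ⌊ P? ⌋ ≡ false
isYes-false P? ¬p = trans (isYes≗does P?) (dec-false P? ¬p)

isYes-⇔ : ∀ {P Q : Set} → P ⇔ Q → (P? : Dec P) (Q? : Dec Q) → ⌊ P? ⌋ ≡ ⌊ Q? ⌋
isYes-⇔ P⇔Q P? Q? =
  trans (isYes≗does P?) (trans (does-⇔ P⇔Q P? Q?) (sym (isYes≗does Q?)))

⊎₃-map : ∀ {A : Set} {P Q : A → Set} {a₁ a₂ a₃} → (∀ {a} → P a → Q a) →
         P a₁ ⊎ P a₂ ⊎ P a₃ → Q a₁ ⊎ Q a₂ ⊎ Q a₃
⊎₃-map g = Sum.map g (Sum.map g g)

module _ {m} {P : Fin m → Set} (P? : ∀ x → Dec (P x)) where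

  ∈-decSubset⁻ : ∀ {x} → x ∈ tabulate (λ y → ⌊ P? y ⌋) → P x
  ∈-decSubset⁻ {x} x∈ = isYes⁻ (P? x) (trans (sym (lookup∘tabulate _ x)) ([]=⇒lookup x∈))

  ∈-decSubset⁺ : ∀ {x} → P x → x ∈ tabulate (λ y → ⌊ P? y ⌋)
  ∈-decSubset⁺ {x} px = lookup⇒[]= x _ (trans (lookup∘tabulate _ x) (isYes⁺ (P? x) px))

⊆-antisym′ : ∀ {m} {p q : Subset m} → (∀ x → x ∈ p → x ∈ q) → (∀ x → x ∈ q → x ∈ p) → p ≡ q
⊆-antisym′ p⊆q q⊆p = ⊆-antisym (λ {x} → p⊆q x) (λ {x} → q⊆p x)

enum : ∀ {n} (K : Subset n) → Fin ∣ K ∣ → Fin n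
enum (true ∷ K) zero = zero
enum (true ∷ K) (suc i) = suc (enum K i)
enum (false ∷ K) i = suc (enum K i)

index : ∀ {n} (K : Subset n) v → v ∈ K → Fin ∣ K ∣
index (true ∷ K) zero here = zero
index (true ∷ K) (suc v) (there v∈K) = suc (index K v v∈K)
index (false ∷ K) (suc v) (there v∈K) = index K v v∈K

enum∈ : ∀ {n} (K : Subset n) i → enum K i ∈ K
enum∈ (true ∷ K) zero = here
enum∈ (true ∷ K) (suc i) = there (enum∈ K i)
enum∈ (false ∷ K) i = there (enum∈ K i)

enum-index : ∀ {n} (K : Subset n) v v∈K → enum K (index K v v∈K) ≡ v
enum-index (true ∷ K) zero here = refl
enum-index (true ∷ K) (suc v) (there v∈K) = cong suc (enum-index K v v∈K)
enum-index (false ∷ K) (suc v) (there v∈K) = cong suc (enum-index K v v∈K)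

index-enum : ∀ {n} (K : Subset n) i i∈K → index K (enum K i) i∈K ≡ i
index-enum (true ∷ K) zero here = refl
index-enum (true ∷ K) (suc i) (there i∈K) = cong suc (index-enum K i i∈K)
index-enum (false ∷ K) i (there i∈K) = index-enum K i i∈K

index-irrelevant : ∀ {n} (K : Subset n) v p q → index K v p ≡ index K v q
index-irrelevant (true ∷ K) zero here here = refl
index-irrelevant (true ∷ K) (suc v) (there p) (there q) = cong suc (index-irrelevant K v p q)
index-irrelevant (false ∷ K) (suc v) (there p) (there q) = index-irrelevant K v p q

index-cong : ∀ {n} (K : Subset n) {v w} → v ≡ w → ∀ p q → index K v p ≡ index K w q
index-cong K refl = index-irrelevant K _

index-injective : ∀ {n} (K : Subset n) {v w} p q → index K v p ≡ index K w q → v ≡ w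
index-injective K {v} {w} p q e =
  trans (sym (enum-index K v p)) (trans (cong (enum K) e) (enum-index K w q))

enum-injective : ∀ {n} (K : Subset n) {i j} → enum K i ≡ enum K j → i ≡ j
enum-injective K {i} {j} e = trans (sym (index-enum K i (enum∈ K i)))
  (trans (index-cong K e (enum∈ K i) (enum∈ K j)) (index-enum K j (enum∈ K j)))

∣∣-mono-injection : ∀ {a b} (S : Subset a) (T : Subset b) (g : ∀ x → x ∈ S → Fin b) →
  (∀ x x∈S → g x x∈S ∈ T) → (∀ x y x∈S y∈S → g x x∈S ≡ g y y∈S → x ≡ y) → ∣ S ∣ ≤ ∣ T ∣
∣∣-mono-injection S T g g∈T g-inj with ∣ S ∣ ≤? ∣ T ∣
... | yes S≤T = S≤T
... | no S≰T with pigeonhole (ℕ.≰⇒> S≰T) (λ i → index T (g (enum S i) (enum∈ S i)) (g∈T _ _))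
... | i , j , i<j , e = ⊥-elim (<⇒≢ i<j (enum-injective S
        (g-inj _ _ (enum∈ S i) (enum∈ S j) (index-injective T (g∈T _ _) (g∈T _ _) e))))

no-three-in-pair : ∀ {n} {S : Subset n} {a b c} → ∣ S ∣ ≤ 2 →
  a ∈ S → b ∈ S → c ∈ S → a ≢ b → a ≢ c → b ≢ c → ⊥
no-three-in-pair {S = S} {a} {b} {c} ∣S∣≤2 a∈S b∈S c∈S a≢b a≢c b≢c =
  ℕ.<⇒≱ (s≤s ∣S∣≤2) (∣∣-mono-injection ⊤ S g g∈S g-inj)
  where
  g : (i : Fin 3) → i ∈ ⊤ → Fin _
  g zero _ = a
  g (suc zero) _ = b
  g (suc (suc zero)) _ = c
  g∈S : ∀ i i∈⊤ → g i i∈⊤ ∈ S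
  g∈S zero _ = a∈S
  g∈S (suc zero) _ = b∈S
  g∈S (suc (suc zero)) _ = c∈S
  g-inj : ∀ i j i∈⊤ j∈⊤ → g i i∈⊤ ≡ g j j∈⊤ → i ≡ j
  g-inj zero zero _ _ _ = refl
  g-inj zero (suc zero) _ _ e = ⊥-elim (a≢b e)
  g-inj zero (suc (suc zero)) _ _ e = ⊥-elim (a≢c e)
  g-inj (suc zero) zero _ _ e = ⊥-elim (a≢b (sym e))
  g-inj (suc zero) (suc zero) _ _ _ = refl
  g-inj (suc zero) (suc (suc zero)) _ _ e = ⊥-elim (b≢c e)
  g-inj (suc (suc zero)) zero _ _ e = ⊥-elim (a≢c (sym e))
  g-inj (suc (suc zero)) (suc zero) _ _ e = ⊥-elim (b≢c (sym e))
  g-inj (suc (suc zero)) (suc (suc zero)) _ _ _ = refl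

Adj-sym : ∀ G {u v} → Adj G u v → Adj G v u
Adj-sym G {u} {v} uv = trans (E-sym G v u) uv

Adj-irrefl : ∀ G {u} → ¬ Adj G u u
Adj-irrefl G {u} uu with trans (sym (E-irr G u)) uu
... | ()

Adj? : ∀ G u v → Dec (Adj G u v)
Adj? G u v = E G u v Bool.≟ true

module _ {G : Graph} {S : VSet G} where

  walk-start : ∀ {u v} → WalkIn G S u v → u ∈ S
  walk-start (stop u∈S) = u∈S
  walk-start (step u∈S _ _) = u∈S

  walk-end : ∀ {u v} → WalkIn G S u v → v ∈ S
  walk-end (stop v∈S) = v∈S
  walk-end (step _ _ w) = walk-end w

  _++ʷ_ : ∀ {u v w} → WalkIn G S u v → WalkIn G S v w → WalkIn G S u w
  stop _ ++ʷ q = q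
  step u∈S uw p ++ʷ q = step u∈S uw (p ++ʷ q)

  walk-snoc : ∀ {u v w} → WalkIn G S u v → Adj G v w → w ∈ S → WalkIn G S u w
  walk-snoc p vw w∈S = p ++ʷ step (walk-end p) vw (stop w∈S)

  walk-reverse : ∀ {u v} → WalkIn G S u v → WalkIn G S v u
  walk-reverse (stop u∈S) = stop u∈S
  walk-reverse (step u∈S uw p) = walk-snoc (walk-reverse p) (Adj-sym G uw) u∈S

walk-mono : ∀ {G S T u v} → (∀ x → x ∈ S → x ∈ T) → WalkIn G S u v → WalkIn G T u v
walk-mono S⊆T (stop u∈S) = stop (S⊆T _ u∈S)
walk-mono S⊆T (step u∈S uw p) = step (S⊆T _ u∈S) uw (walk-mono S⊆T p)

module _ {G : Graph} {A B : VSet G} (sep : IsSep G A B) where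

  ∉B⇒∈A : ∀ {v} → v ∉ B → v ∈ A
  ∉B⇒∈A v∉B = [ id , ⊥-elim ∘ v∉B ] (proj₁ sep _)

  ∉A⇒∈B : ∀ {v} → v ∉ A → v ∈ B
  ∉A⇒∈B v∉A = [ ⊥-elim ∘ v∉A , id ] (proj₁ sep _)

  sep-edge : ∀ {u v} → Adj G u v → (u ∈ A × v ∈ A) ⊎ (u ∈ B × v ∈ B)
  sep-edge {u} {v} uv with u ∈? B | v ∈? B
  ... | yes u∈B | yes v∈B = inj₂ (u∈B , v∈B)
  ... | no u∉B | _ with v ∈? A
  ...   | yes v∈A = inj₁ (∉B⇒∈A u∉B , v∈A)
  ...   | no v∉A = ⊥-elim (proj₂ sep u v (∉B⇒∈A u∉B) u∉B (∉A⇒∈B v∉A) v∉A uv)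
  sep-edge {u} {v} uv | yes u∈B | no v∉B with u ∈? A
  ...   | yes u∈A = inj₁ (u∈A , ∉B⇒∈A v∉B)
  ...   | no u∉A = ⊥-elim (proj₂ sep v u (∉B⇒∈A v∉B) v∉B u∈B u∉A (Adj-sym G uv))

  sep-covers : Covers3 G A B A
  sep-covers = (λ v → Sum.map₂ inj₁ (proj₁ sep v))
             , (λ u v uv → Sum.map₂ inj₁ (sep-edge uv))

  walk-meets-separator : ∀ {S a b} → WalkIn G S a b → a ∈ A → b ∈ B →
                         ∃ λ w → w ∈ S × w ∈ A × w ∈ B
  walk-meets-separator {a = a} (stop a∈S) a∈A a∈B = a , a∈S , a∈A , a∈B
  walk-meets-separator {a = a} (step a∈S aw p) a∈A b∈B with a ∈? B
  ... | yes a∈B = a , a∈S , a∈A , a∈B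
  ... | no a∉B with sep-edge aw
  ...   | inj₁ (_ , w∈A) = walk-meets-separator p w∈A b∈B
  ...   | inj₂ (a∈B , _) = ⊥-elim (a∉B a∈B)

IsTangle-resp-⇔ : ∀ {G k} {τ σ : OrientedSepSet G} → IsTangle G k τ →
  (∀ A B → τ A B → σ A B) → (∀ A B → σ A B → τ A B) → IsTangle G k σ
IsTangle-resp-⇔ T τ⇒σ σ⇒τ = record
  { members   = λ A B s → members A B (σ⇒τ A B s)
  ; total     = λ A B sep o → Sum.map (τ⇒σ A B) (τ⇒σ B A) (total A B sep o)
  ; exclusive = λ A B s s′ → exclusive A B (σ⇒τ A B s) (σ⇒τ B A s′)
  ; no-cover  = λ A₁ B₁ A₂ B₂ A₃ B₃ s₁ s₂ s₃ →
                  no-cover A₁ B₁ A₂ B₂ A₃ B₃ (σ⇒τ _ _ s₁) (σ⇒τ _ _ s₂) (σ⇒τ _ _ s₃)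
  }
  where open IsTangle T

module _ {G H : Graph} (φ : MinorMap G H) where

  ∈-branch⁻ : ∀ {x u} → u ∈ branch φ x → f φ u ≡ just x
  ∈-branch⁻ {x} = ∈-decSubset⁻ (λ u → f φ u ≟M just x)

  ∈-branch⁺ : ∀ {x u} → f φ u ≡ just x → u ∈ branch φ x
  ∈-branch⁺ {x} = ∈-decSubset⁺ (λ u → f φ u ≟M just x)

  ∈-imgSet⁻ : ∀ {A x} → x ∈ imgSet φ A → ∃ λ u → u ∈ A × f φ u ≡ just x
  ∈-imgSet⁻ {A} = ∈-decSubset⁻ (λ x → any? (λ u → (u ∈? A) ×-dec (f φ u ≟M just x)))

  ∈-imgSet⁺ : ∀ {A x u} → u ∈ A → f φ u ≡ just x → x ∈ imgSet φ A
  ∈-imgSet⁺ {A} u∈A e = ∈-decSubset⁺ (λ x → any? (λ u → (u ∈? A) ×-dec (f φ u ≟M just x)))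
                                     (_ , u∈A , e)

  imgSet-isSep : ∀ {A B} → IsSep G A B → IsSep H (imgSet φ A) (imgSet φ B)
  imgSet-isSep {A} {B} sep = cover , no-edge
    where
    cover : ∀ x → x ∈ imgSet φ A ⊎ x ∈ imgSet φ B
    cover x with surj φ x
    ... | u , fu = Sum.map (λ u∈A → ∈-imgSet⁺ u∈A fu) (λ u∈B → ∈-imgSet⁺ u∈B fu) (proj₁ sep u)
    no-edge : ∀ x y → x ∈ imgSet φ A → x ∉ imgSet φ B → y ∈ imgSet φ B → y ∉ imgSet φ A →
              ¬ Adj H x y
    no-edge x y _ x∉φB _ y∉φA xy with edges φ x y xy
    ... | u , v , fu , fv , uv with sep-edge {G} {A} {B} sep uv
    ...   | inj₁ (_ , v∈A) = y∉φA (∈-imgSet⁺ v∈A fv)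
    ...   | inj₂ (u∈B , _) = x∉φB (∈-imgSet⁺ u∈B fu)

  -- Every vertex of φ(A) ∩ φ(B) has a connected branch set meeting both A and B,
  -- hence meeting A ∩ B; distinct branch sets give distinct vertices of A ∩ B.
  imgSet-order-≤ : ∀ {A B} → IsSep G A B → order H (imgSet φ A) (imgSet φ B) ≤ order G A B
  imgSet-order-≤ {A} {B} sep = ∣∣-mono-injection _ _ (λ x p → proj₁ (witness x p)) w∈A∩B w-inj
    where
    witness : ∀ x → x ∈ imgSet φ A ∩ imgSet φ B → ∃ λ w → w ∈ branch φ x × w ∈ A × w ∈ B
    witness x x∈ with x∈p∩q⁻ _ _ x∈
    ... | x∈φA , x∈φB with ∈-imgSet⁻ x∈φA | ∈-imgSet⁻ x∈φB
    ... | a , a∈A , fa | b , b∈B , fb =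
      walk-meets-separator sep (branch-conn φ x a b (∈-branch⁺ fa) (∈-branch⁺ fb)) a∈A b∈B
    w∈A∩B : ∀ x x∈ → proj₁ (witness x x∈) ∈ A ∩ B
    w∈A∩B x x∈ with witness x x∈
    ... | _ , _ , w∈A , w∈B = x∈p∩q⁺ (w∈A , w∈B)
    w-inj : ∀ x y x∈ y∈ → proj₁ (witness x x∈) ≡ proj₁ (witness y y∈) → x ≡ y
    w-inj x y x∈ y∈ e with witness x x∈ | witness y y∈
    ... | _ , w∈φx , _ | _ , w∈φy , _ =
      just-injective (trans (sym (∈-branch⁻ w∈φx)) (trans (cong (f φ) e) (∈-branch⁻ w∈φy)))

record Pullback {G H : Graph} (φ : MinorMap G H) (τ : OrientedSepSet G) : Set where
  field
    pullA   : VSet H → VSet G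
    pullB   : VSet H → VSet H → VSet G
    isSep   : ∀ {C D} → IsSep H C D → IsSep G (pullA C) (pullB C D)
    order-≤ : ∀ C D → order G (pullA C) (pullB C D) ≤ order H C D
    imgA    : ∀ C → imgSet φ (pullA C) ≡ C
    imgB    : ∀ {C D} → IsSep H C D → imgSet φ (pullB C D) ≡ D
    pull-img-∈ : ∀ {A B} → τ A B → τ (pullA (imgSet φ A)) (pullB (imgSet φ A) (imgSet φ B))
    pull-covers : ∀ {C₁ C₂ C₃} → Covers3 H C₁ C₂ C₃ →
                  Covers3 G (pullA C₁) (pullA C₂) (pullA C₃)

imgτ-isTangle : ∀ {G H k} {τ : OrientedSepSet G} {φ : MinorMap G H} →
  IsTangle G k τ → Pullback φ τ → IsTangle H k (imgτ φ τ)
imgτ-isTangle {G} {H} {k} {τ} {φ} T pb = record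
  { members = members′ ; total = total′ ; exclusive = exclusive′ ; no-cover = no-cover′ }
  where
  open IsTangle T
  open Pullback pb
  members′ : ∀ C D → imgτ φ τ C D → IsSep H C D × order H C D < k
  members′ _ _ (A , B , t , refl , refl) with members A B t
  ... | sep , o = imgSet-isSep φ sep , ℕ.≤-<-trans (imgSet-order-≤ φ sep) o
  total′ : ∀ C D → IsSep H C D → order H C D < k → imgτ φ τ C D ⊎ imgτ φ τ D C
  total′ C D sep o with total (pullA C) (pullB C D) (isSep sep) (ℕ.≤-<-trans (order-≤ C D) o)
  ... | inj₁ t = inj₁ (_ , _ , t , imgA C , imgB sep)
  ... | inj₂ t = inj₂ (_ , _ , t , imgB sep , imgA C)
  no-cover′ : ∀ C₁ D₁ C₂ D₂ C₃ D₃ → imgτ φ τ C₁ D₁ → imgτ φ τ C₂ D₂ → imgτ φ τ C₃ D₃ →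
              ¬ Covers3 H C₁ C₂ C₃
  no-cover′ _ _ _ _ _ _ (_ , _ , t₁ , refl , refl) (_ , _ , t₂ , refl , refl)
            (_ , _ , t₃ , refl , refl) cov =
    no-cover _ _ _ _ _ _ (pull-img-∈ t₁) (pull-img-∈ t₂) (pull-img-∈ t₃) (pull-covers cov)
  exclusive′ : ∀ C D → imgτ φ τ C D → imgτ φ τ D C → C ≡ D
  exclusive′ C D CD DC =
    ⊥-elim (no-cover′ C D D C C D CD DC CD (sep-covers {H} {C} {D} (proj₁ (members′ C D CD))))

idMinor : ∀ G → MinorMap G G
idMinor G = record
  { f = just ; surj = λ x → x , refl ; branch-conn = conn
  ; edges = λ x y xy → x , y , refl , refl , xy }
  where
  conn : ∀ x u v → u ∈ _ → v ∈ _ → WalkIn G _ u v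
  conn x u v u∈ v∈ with ∈-decSubset⁻ (λ u → just u ≟M just x) u∈
                      | ∈-decSubset⁻ (λ u → just u ≟M just x) v∈
  ... | refl | refl = stop u∈

imgSet-id : ∀ G A → imgSet (idMinor G) A ≡ A
imgSet-id G A = ⊆-antisym′ (λ x x∈ → ∈-id (∈-imgSet⁻ (idMinor G) x∈))
                           (λ x x∈A → ∈-imgSet⁺ (idMinor G) x∈A refl)
  where
  ∈-id : ∀ {x} → ∃ (λ u → u ∈ A × just u ≡ just x) → x ∈ A
  ∈-id (_ , u∈A , refl) = u∈A

module _ {G H K : Graph} (φ : MinorMap G H) (ψ : MinorMap H K) where

  private
    fψφ : V G → Maybe (V K)
    fψφ u = f φ u >>= f ψ

    >>=-just⁻ : ∀ {u z} → fψφ u ≡ just z → ∃ λ y → f φ u ≡ just y × f ψ y ≡ just z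
    >>=-just⁻ {u} e with f φ u
    ... | just y = y , refl , e

    >>=-just⁺ : ∀ {u y z} → f φ u ≡ just y → f ψ y ≡ just z → fψφ u ≡ just z
    >>=-just⁺ fu e = trans (cong (_>>= f ψ) fu) e

    ∈-branchψφ⁺ : ∀ {z u} → fψφ u ≡ just z → u ∈ tabulate (λ u → ⌊ fψφ u ≟M just z ⌋)
    ∈-branchψφ⁺ {z} = ∈-decSubset⁺ (λ u → fψφ u ≟M just z)

    branch⊆ : ∀ {y z} → f ψ y ≡ just z → ∀ w → w ∈ branch φ y →
              w ∈ tabulate (λ u → ⌊ fψφ u ≟M just z ⌋)
    branch⊆ fy w w∈ = ∈-branchψφ⁺ (>>=-just⁺ (∈-branch⁻ φ w∈) fy)

    lift : ∀ {S y y′ z} → WalkIn H S y y′ → (∀ w → w ∈ S → f ψ w ≡ just z) →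
           ∀ {u u′} → f φ u ≡ just y → f φ u′ ≡ just y′ →
           WalkIn G (tabulate (λ u → ⌊ fψφ u ≟M just z ⌋)) u u′
    lift (stop {y} y∈S) S↦z fu fu′ =
      walk-mono (branch⊆ (S↦z y y∈S)) (branch-conn φ y _ _ (∈-branch⁺ φ fu) (∈-branch⁺ φ fu′))
    lift (step {y} {w} y∈S yw p) S↦z fu fu′ with edges φ y w yw
    ... | a , b , fa , fb , ab =
      walk-mono (branch⊆ (S↦z y y∈S)) (branch-conn φ y _ _ (∈-branch⁺ φ fu) (∈-branch⁺ φ fa))
        ++ʷ step (∈-branchψφ⁺ (>>=-just⁺ fa (S↦z y y∈S))) ab (lift p S↦z fb fu′)

  _∘ᴹ_ : MinorMap G K
  _∘ᴹ_ = record { f = fψφ ; surj = surj′ ; branch-conn = conn ; edges = edges′ }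
    where
    surj′ : ∀ z → ∃ λ u → fψφ u ≡ just z
    surj′ z with surj ψ z
    ... | y , fy with surj φ y
    ... | u , fu = u , >>=-just⁺ fu fy
    conn : ∀ z u u′ → _ → _ → WalkIn G _ u u′
    conn z u u′ u∈ u′∈ with >>=-just⁻ (∈-decSubset⁻ (λ u → fψφ u ≟M just z) u∈)
                          | >>=-just⁻ (∈-decSubset⁻ (λ u → fψφ u ≟M just z) u′∈)
    ... | y , fu , fy | y′ , fu′ , fy′ =
      lift (branch-conn ψ z y y′ (∈-branch⁺ ψ fy) (∈-branch⁺ ψ fy′)) (λ w → ∈-branch⁻ ψ) fu fu′
    edges′ : ∀ z z′ → Adj K z z′ → ∃₂ λ u v → fψφ u ≡ just z × fψφ v ≡ just z′ × Adj G u v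
    edges′ z z′ zz′ with edges ψ z z′ zz′
    ... | y , y′ , fy , fy′ , yy′ with edges φ y y′ yy′
    ... | u , v , fu , fv , uv = u , v , >>=-just⁺ fu fy , >>=-just⁺ fv fy′ , uv

  imgSet-∘ : ∀ A → imgSet _∘ᴹ_ A ≡ imgSet ψ (imgSet φ A)
  imgSet-∘ A = ⊆-antisym′ to from
    where
    to : ∀ z → z ∈ imgSet _∘ᴹ_ A → z ∈ imgSet ψ (imgSet φ A)
    to z z∈ with ∈-imgSet⁻ _∘ᴹ_ z∈
    ... | u , u∈A , fu with >>=-just⁻ fu
    ... | y , fu′ , fy = ∈-imgSet⁺ ψ (∈-imgSet⁺ φ u∈A fu′) fy
    from : ∀ z → z ∈ imgSet ψ (imgSet φ A) → z ∈ imgSet _∘ᴹ_ A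
    from z z∈ with ∈-imgSet⁻ ψ z∈
    ... | y , y∈ , fy with ∈-imgSet⁻ φ y∈
    ... | u , u∈A , fu = ∈-imgSet⁺ _∘ᴹ_ u∈A (>>=-just⁺ fu fy)

  imgτ-∘⁻ : ∀ τ C D → imgτ _∘ᴹ_ τ C D → imgτ ψ (imgτ φ τ) C D
  imgτ-∘⁻ τ C D (A , B , t , refl , refl) =
    imgSet φ A , imgSet φ B , (A , B , t , refl , refl) , sym (imgSet-∘ A) , sym (imgSet-∘ B)

  imgτ-∘⁺ : ∀ τ C D → imgτ ψ (imgτ φ τ) C D → imgτ _∘ᴹ_ τ C D
  imgτ-∘⁺ τ C D (_ , _ , (A , B , t , refl , refl) , refl , refl) =
    A , B , t , imgSet-∘ A , imgSet-∘ B

Neighbour : ∀ G → VSet G → V G → Set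
Neighbour G R w = w ∉ R × ∃ λ z → z ∈ R × Adj G z w

Neighbour? : ∀ G R w → Dec (Neighbour G R w)
Neighbour? G R w = ¬? (w ∈? R) ×-dec any? (λ z → (z ∈? R) ×-dec Adj? G z w)

nbhd : ∀ G → VSet G → VSet G
nbhd G R = tabulate (λ w → ⌊ Neighbour? G R w ⌋)

record Reachable (G : Graph) (S : VSet G) (u : V G) : Set where
  field
    R      : VSet G
    u∈R    : u ∈ R
    walks  : ∀ r → r ∈ R → WalkIn G S u r
    closed : ∀ z w → z ∈ R → w ∈ S → Adj G z w → w ∈ R

-- Add S-neighbours of R one at a time; the fuel k bounds how many are still missing.
grow : ∀ G S u k (R : VSet G) → n G ≤ ∣ R ∣ + k → u ∈ R → (∀ r → r ∈ R → WalkIn G S u r) →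
       Reachable G S u
grow G S u k R n≤ u∈R walks
  with any? (λ w → (w ∈? S) ×-dec Neighbour? G R w)
... | no ¬new = record { R = R ; u∈R = u∈R ; walks = walks ; closed = closed }
  where
  closed : ∀ z w → z ∈ R → w ∈ S → Adj G z w → w ∈ R
  closed z w z∈R w∈S zw with w ∈? R
  ... | yes w∈R = w∈R
  ... | no w∉R = ⊥-elim (¬new (w , w∈S , w∉R , z , z∈R , zw))
grow G S u zero R n≤ u∈R walks | yes (w , _ , w∉R , _) =
  ⊥-elim (w∉R (subst (w ∈_) (sym (∣p∣≡n⇒p≡⊤ (ℕ.≤-antisym (∣p∣≤n R) R-full))) ∈⊤))
  where
  R-full : n G ≤ ∣ R ∣
  R-full = subst (n G ≤_) (ℕ.+-identityʳ _) n≤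
grow G S u (suc k) R n≤ u∈R walks | yes (w , w∈S , w∉R , z , z∈R , zw) =
  grow G S u k (R ∪ ⁅ w ⁆) n≤′ (p⊆p∪q ⁅ w ⁆ u∈R) walks′
  where
  R⊂R∪w : ∣ R ∣ < ∣ R ∪ ⁅ w ⁆ ∣
  R⊂R∪w = p⊂q⇒∣p∣<∣q∣ (p⊆p∪q ⁅ w ⁆ , w , q⊆p∪q R ⁅ w ⁆ (x∈⁅x⁆ w) , w∉R)
  n≤′ : n G ≤ ∣ R ∪ ⁅ w ⁆ ∣ + k
  n≤′ = ℕ.≤-trans n≤ (subst (_≤ ∣ R ∪ ⁅ w ⁆ ∣ + k) (sym (ℕ.+-suc ∣ R ∣ k)) (ℕ.+-monoˡ-≤ k R⊂R∪w))
  walks′ : ∀ r → r ∈ R ∪ ⁅ w ⁆ → WalkIn G S u r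
  walks′ r r∈ with x∈p∪q⁻ R ⁅ w ⁆ r∈
  ... | inj₁ r∈R = walks r r∈R
  ... | inj₂ r∈w with x∈⁅y⁆⇒x≡y w r∈w
  ...   | refl = walk-snoc (walks z z∈R) zw w∈S

reachable : ∀ G S u → u ∈ S → Reachable G S u
reachable G S u u∈S = grow G S u (n G) ⁅ u ⁆ (ℕ.m≤n+m (n G) _) (x∈⁅x⁆ u) walks
  where
  walks : ∀ r → r ∈ ⁅ u ⁆ → WalkIn G S u r
  walks r r∈u with x∈⁅y⁆⇒x≡y u r∈u
  ... | refl = stop u∈S

module _ {G S u} (Rᵤ : Reachable G S u) where
  open Reachable Rᵤ

  walk-stays-in : ∀ {z w} → z ∈ R → WalkIn G S z w → WalkIn G R z w
  walk-stays-in z∈R (stop _) = stop z∈R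
  walk-stays-in z∈R (step _ zy p) = step z∈R zy (walk-stays-in (closed _ _ z∈R (walk-start p) zy) p)

  Reachable-connected : ConnectedIn G R
  Reachable-connected a b a∈R b∈R =
    walk-reverse (walk-stays-in u∈R (walks a a∈R)) ++ʷ walk-stays-in u∈R (walks b b∈R)

  Reachable⊆ : ∀ {r} → r ∈ R → r ∈ S
  Reachable⊆ r∈R = walk-end (walks _ r∈R)

  walk-from? : ∀ v → Dec (WalkIn G S u v)
  walk-from? v with v ∈? R
  ... | yes v∈R = yes (walks v v∈R)
  ... | no v∉R = no (v∉R ∘ walk-end ∘ walk-stays-in u∈R)

walk? : ∀ G S u v → Dec (WalkIn G S u v)
walk? G S u v with u ∈? S
... | no u∉S = no (u∉S ∘ walk-start)
... | yes u∈S = walk-from? (reachable G S u u∈S) v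

Separable : ℕ → Graph → Set
Separable k G = ∃ λ (X : VSet G) → ∣ X ∣ < k ×
                ∃₂ λ u v → u ∈ ∁ X × v ∈ ∁ X × ¬ WalkIn G (∁ X) u v

KConnected-or-Separable : ∀ k G → k < n G → KConnected k G ⊎ Separable k G
KConnected-or-Separable k G k<n with anySubset? separates?
  where
  separates? : ∀ X → Dec (∣ X ∣ < k × ∃₂ λ u v → u ∈ ∁ X × v ∈ ∁ X × ¬ WalkIn G (∁ X) u v)
  separates? X = (∣ X ∣ <? k) ×-dec any? λ u → any? λ v →
                 (u ∈? ∁ X) ×-dec (v ∈? ∁ X) ×-dec ¬? (walk? G (∁ X) u v)
... | yes sep = inj₂ sep
... | no ¬sep = inj₁ (k<n , connected)
  where
  connected : ∀ X → ∣ X ∣ < k → ConnectedIn G (∁ X)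
  connected X ∣X∣<k u v u∈ v∈ with walk? G (∁ X) u v
  ... | yes walk = walk
  ... | no ¬walk = ⊥-elim (¬sep (X , ∣X∣<k , u , v , u∈ , v∈ , ¬walk))

module _ (G : Graph) (R : VSet G) where

  private
    N : VSet G
    N = nbhd G R

  ∈-nbhd⁻ : ∀ {w} → w ∈ N → Neighbour G R w
  ∈-nbhd⁻ = ∈-decSubset⁻ (Neighbour? G R)

  ∈-nbhd⁺ : ∀ {w} → Neighbour G R w → w ∈ N
  ∈-nbhd⁺ = ∈-decSubset⁺ (Neighbour? G R)

  nbhd-isSep : IsSep G (R ∪ N) (∁ R)
  nbhd-isSep = cover , no-edge
    where
    cover : ∀ v → v ∈ R ∪ N ⊎ v ∈ ∁ R
    cover v with v ∈? R
    ... | yes v∈R = inj₁ (p⊆p∪q N v∈R)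
    ... | no v∉R = inj₂ (x∉p⇒x∈∁p v∉R)
    no-edge : ∀ a b → a ∈ R ∪ N → a ∉ ∁ R → b ∈ ∁ R → b ∉ R ∪ N → ¬ Adj G a b
    no-edge a b _ a∉∁R b∈∁R b∉ ab =
      b∉ (q⊆p∪q R N (∈-nbhd⁺ (x∈∁p⇒x∉p b∈∁R , a , x∉∁p⇒x∈p a∉∁R , ab)))

  nbhd-order≤ : order G (R ∪ N) (∁ R) ≤ ∣ N ∣
  nbhd-order≤ = p⊆q⇒∣p∣≤∣q∣ ∩⊆N
    where
    ∩⊆N : ∀ {x} → x ∈ (R ∪ N) ∩ ∁ R → x ∈ N
    ∩⊆N x∈ with x∈p∩q⁻ _ _ x∈
    ... | x∈R∪N , x∈∁R = [ ⊥-elim ∘ x∈∁p⇒x∉p x∈∁R , id ] (x∈p∪q⁻ R N x∈R∪N)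

-- τ-away says that R lies on the small side of τ.
record SmallSide (G : Graph) (τ : OrientedSepSet G) (k : ℕ) : Set where
  field
    R         : VSet G
    r₀        : V G
    r₀∈R      : r₀ ∈ R
    connected : ConnectedIn G R
    ∣N∣<k     : ∣ nbhd G R ∣ < k
    τ-away    : τ (R ∪ nbhd G R) (∁ R)

module _ {G X w} (Rw : Reachable G (∁ X) w) where
  open Reachable Rw

  nbhd-Reachable⊆ : ∀ {x} → x ∈ nbhd G R → x ∈ X
  nbhd-Reachable⊆ {x} x∈N with ∈-nbhd⁻ G R x∈N | x ∈? ∁ X
  ... | x∉R , z , z∈R , zx | yes x∈∁X = ⊥-elim (x∉R (closed z x z∈R x∈∁X zx))
  ... | _ | no x∉∁X = x∉∁p⇒x∈p x∉∁X

smallSide : ∀ {G τ k} → IsTangle G (suc k) τ → Separable k G → SmallSide G τ k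
smallSide {G} {τ} {k} T (X , ∣X∣<k , u , v , u∈ , v∈ , ¬uv) =
  choose (orient Rᵤ) (orient Rᵥ)
  where
  open IsTangle T
  Rᵤ : Reachable G (∁ X) u
  Rᵤ = reachable G (∁ X) u u∈
  Rᵥ : Reachable G (∁ X) v
  Rᵥ = reachable G (∁ X) v v∈
  module U = Reachable Rᵤ
  module W = Reachable Rᵥ

  Side : VSet G → Set
  Side R = τ (R ∪ nbhd G R) (∁ R) ⊎ τ (∁ R) (R ∪ nbhd G R)

  ∣N∣<k : ∀ {w} (Rw : Reachable G (∁ X) w) → ∣ nbhd G (Reachable.R Rw) ∣ < k
  ∣N∣<k Rw = ℕ.≤-<-trans (p⊆q⇒∣p∣≤∣q∣ (nbhd-Reachable⊆ Rw)) ∣X∣<k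

  orient : ∀ {w} (Rw : Reachable G (∁ X) w) → Side (Reachable.R Rw)
  orient Rw = total _ _ (nbhd-isSep G _)
    (ℕ.≤-<-trans (nbhd-order≤ G _) (ℕ.m<n⇒m<1+n (∣N∣<k Rw)))

  side : ∀ {w} (Rw : Reachable G (∁ X) w) → τ (Reachable.R Rw ∪ _) _ → SmallSide G τ k
  side {w} Rw t = record
    { R = R ; r₀ = w ; r₀∈R = u∈R ; connected = Reachable-connected Rw
    ; ∣N∣<k = ∣N∣<k Rw ; τ-away = t }
    where open Reachable Rw

  disjoint : ∀ {x} → x ∈ U.R → x ∉ W.R
  disjoint {x} x∈U x∈W = ¬uv (U.walks x x∈U ++ʷ walk-reverse (W.walks x x∈W))

  U-edge-∉W : ∀ {a b} → a ∈ U.R → Adj G a b → b ∉ W.R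
  U-edge-∉W {a} {b} a∈U ab b∈W = disjoint (U.closed a b a∈U (Reachable⊆ Rᵥ b∈W) ab) b∈W

  cover : Covers3 G (∁ U.R) (∁ W.R) (∁ U.R)
  cover = vertices , edges′
    where
    vertices : ∀ x → x ∈ ∁ U.R ⊎ x ∈ ∁ W.R ⊎ x ∈ ∁ U.R
    vertices x with x ∈? U.R
    ... | yes x∈U = inj₂ (inj₁ (x∉p⇒x∈∁p (disjoint x∈U)))
    ... | no x∉U = inj₁ (x∉p⇒x∈∁p x∉U)
    edges′ : ∀ a b → Adj G a b →
      (a ∈ ∁ U.R × b ∈ ∁ U.R) ⊎ (a ∈ ∁ W.R × b ∈ ∁ W.R) ⊎ (a ∈ ∁ U.R × b ∈ ∁ U.R)
    edges′ a b ab with a ∈? U.R | b ∈? U.R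
    ... | yes a∈U | _ =
      inj₂ (inj₁ (x∉p⇒x∈∁p (disjoint a∈U) , x∉p⇒x∈∁p (U-edge-∉W a∈U ab)))
    ... | no _ | yes b∈U =
      inj₂ (inj₁ (x∉p⇒x∈∁p (U-edge-∉W b∈U (Adj-sym G ab)) , x∉p⇒x∈∁p (disjoint b∈U)))
    ... | no a∉U | no b∉U = inj₁ (x∉p⇒x∈∁p a∉U , x∉p⇒x∈∁p b∉U)

  choose : Side U.R → Side W.R → SmallSide G τ k
  choose (inj₁ t) _ = side Rᵤ t
  choose (inj₂ _) (inj₁ t) = side Rᵥ t
  choose (inj₂ tᵤ) (inj₂ tᵥ) = ⊥-elim (no-cover _ _ _ _ _ _ tᵤ tᵥ tᵤ cover)

-- H is G − R plus an edge joining the at most two vertices of N = N(R); its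
-- vertices are the indices of K = V(G) ∖ R. The minor map contracts R into one
-- vertex x₀ of N (and deletes R if N = ∅), so that R realises the new edge.
module Contraction {G τ k} (T : IsTangle G k τ) (small : SmallSide G τ 3) where
  open SmallSide small

  N K : VSet G
  N = nbhd G R
  K = ∁ R

  m : ℕ
  m = ∣ K ∣

  N∉R : ∀ {x} → x ∈ N → x ∉ R
  N∉R = proj₁ ∘ ∈-nbhd⁻ G R

  ι : ∀ v → v ∉ R → Fin m
  ι v v∉R = index K v (x∉p⇒x∈∁p v∉R)

  ι-injective : ∀ {v w} v∉R w∉R → ι v v∉R ≡ ι w w∉R → v ≡ w
  ι-injective _ _ = index-injective K _ _

  ι-cong : ∀ {v w} → v ≡ w → ∀ v∉R w∉R → ι v v∉R ≡ ι w w∉R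
  ι-cong v≡w _ _ = index-cong K v≡w _ _

  enum∉R : ∀ h → enum K h ∉ R
  enum∉R h = x∈∁p⇒x∉p (enum∈ K h)

  enum-ι : ∀ {v} v∉R → enum K (ι v v∉R) ≡ v
  enum-ι _ = enum-index K _ _

  ι-enum : ∀ h → ι (enum K h) (enum∉R h) ≡ h
  ι-enum h = index-enum K h _

  N-pair : ∀ {a b c} → a ∈ N → b ∈ N → c ∈ N → a ≢ b → a ≢ c → b ≢ c → ⊥
  N-pair = no-three-in-pair (ℕ.≤-pred ∣N∣<k)

  R-image : Dec (∃ λ x → x ∈ N) → Maybe (Fin m)
  R-image (yes (x₀ , x₀∈N)) = just (ι x₀ (N∉R x₀∈N))
  R-image (no _) = nothing

  contract′ : ∀ v → Dec (v ∈ R) → Maybe (Fin m)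
  contract′ v (yes _) = R-image (any? (_∈? N))
  contract′ v (no v∉R) = just (ι v v∉R)

  contract : V G → Maybe (Fin m)
  contract v = contract′ v (v ∈? R)

  contract-R : ∀ {v} → v ∈ R → contract v ≡ R-image (any? (_∈? N))
  contract-R {v} v∈R with v ∈? R
  ... | yes _ = refl
  ... | no v∉R = ⊥-elim (v∉R v∈R)

  contract-∉R : ∀ {v} (v∉R : v ∉ R) → contract v ≡ just (ι v v∉R)
  contract-∉R {v} v∉R with v ∈? R
  ... | yes v∈R = ⊥-elim (v∉R v∈R)
  ... | no v∉R′ = cong just (index-irrelevant K v _ _)

  contract-enum : ∀ h → contract (enum K h) ≡ just h
  contract-enum h = trans (contract-∉R (enum∉R h)) (cong just (ι-enum h))

  contract-∉R-enum : ∀ {v h} → v ∉ R → contract v ≡ just h → v ≡ enum K h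
  contract-∉R-enum v∉R e =
    trans (sym (enum-ι v∉R)) (cong (enum K) (just-injective (trans (sym (contract-∉R v∉R)) e)))

  R-image-just : ∀ N? {h} → R-image N? ≡ just h → ∃ λ x → Σ (x ∈ N) λ x∈N → ι x (N∉R x∈N) ≡ h
  R-image-just (yes (x₀ , x₀∈N)) refl = x₀ , x₀∈N , refl

  R-image-nonempty : ∀ N? {x} → x ∈ N →
    ∃ λ x₀ → Σ (x₀ ∈ N) λ x₀∈N → R-image N? ≡ just (ι x₀ (N∉R x₀∈N))
  R-image-nonempty (yes (x₀ , x₀∈N)) _ = x₀ , x₀∈N , refl
  R-image-nonempty (no N≡∅) x∈N = ⊥-elim (N≡∅ (_ , x∈N))

  HEdge : Fin m → Fin m → Set
  HEdge i j = Adj G (enum K i) (enum K j) ⊎ (enum K i ∈ N × enum K j ∈ N × i ≢ j)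

  HEdge? : ∀ i j → Dec (HEdge i j)
  HEdge? i j = Adj? G _ _ ⊎-dec (enum K i ∈? N) ×-dec (enum K j ∈? N) ×-dec ¬? (i ≟ᶠ j)

  HEdge-sym : ∀ {i j} → HEdge i j → HEdge j i
  HEdge-sym = Sum.map (Adj-sym G) (λ (i∈N , j∈N , i≢j) → j∈N , i∈N , i≢j ∘ sym)

  HEdge-irrefl : ∀ {i} → ¬ HEdge i i
  HEdge-irrefl = [ Adj-irrefl G , (λ (_ , _ , i≢i) → i≢i refl) ]

  H : Graph
  H = record
    { n = m
    ; E = λ i j → ⌊ HEdge? i j ⌋
    ; E-sym = λ i j → isYes-⇔ (mk⇔ HEdge-sym HEdge-sym) (HEdge? i j) (HEdge? j i)
    ; E-irr = λ i → isYes-false (HEdge? i i) HEdge-irrefl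
    }

  H-adj⁻ : ∀ {i j} → Adj H i j → HEdge i j
  H-adj⁻ {i} {j} = isYes⁻ (HEdge? i j)

  H-adj-G : ∀ {u v} u∉R v∉R → Adj G u v → Adj H (ι u u∉R) (ι v v∉R)
  H-adj-G {u} {v} u∉R v∉R uv = isYes⁺ (HEdge? _ _)
    (inj₁ (subst₂ (Adj G) (sym (enum-ι u∉R)) (sym (enum-ι v∉R)) uv))

  H-adj-N : ∀ {x y} (x∈N : x ∈ N) (y∈N : y ∈ N) → x ≢ y →
            Adj H (ι x (N∉R x∈N)) (ι y (N∉R y∈N))
  H-adj-N x∈N y∈N x≢y = isYes⁺ (HEdge? _ _)
    (inj₂ ( subst (_∈ N) (sym (enum-ι _)) x∈N , subst (_∈ N) (sym (enum-ι _)) y∈N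
          , x≢y ∘ ι-injective _ _ ))

  private
    Branch : Fin m → VSet G
    Branch h = tabulate (λ u → ⌊ contract u ≟M just h ⌋)

    ∈-Branch : ∀ {h u} → contract u ≡ just h → u ∈ Branch h
    ∈-Branch {h} = ∈-decSubset⁺ (λ u → contract u ≟M just h)

  -- A vertex of R reaches enum h through R and then the edge from R to the
  -- vertex of N onto which R is contracted.
  walk-to-enum : ∀ {h u} → contract u ≡ just h → WalkIn G (Branch h) u (enum K h)
  walk-to-enum {h} {u} cu = by-cases (u ∈? R)
    where
    by-cases : Dec (u ∈ R) → WalkIn G (Branch h) u (enum K h)
    by-cases (no u∉R) =
      subst (WalkIn G (Branch h) u) (contract-∉R-enum u∉R cu) (stop (∈-Branch cu))
    by-cases (yes u∈R) with R-image-just (any? (_∈? N)) (trans (sym (contract-R u∈R)) cu)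
    ... | x , x∈N , ιx≡h with ∈-nbhd⁻ G R x∈N
    ...   | x∉R , z , z∈R , zx =
      subst (WalkIn G (Branch h) u) (trans (sym (enum-ι x∉R)) (cong (enum K) ιx≡h))
        (walk-snoc (walk-mono R⊆Branch (connected u z u∈R z∈R)) zx
                   (∈-Branch (trans (contract-∉R x∉R) (cong just ιx≡h))))
      where
      R⊆Branch : ∀ w → w ∈ R → w ∈ Branch h
      R⊆Branch w w∈R = ∈-Branch (trans (contract-R w∈R) (trans (sym (contract-R u∈R)) cu))

  contract-R-onto : ∀ {x₀ h z} (x₀∈N : x₀ ∈ N) →
    R-image (any? (_∈? N)) ≡ just (ι x₀ (N∉R x₀∈N)) → enum K h ≡ x₀ → z ∈ R → contract z ≡ just h
  contract-R-onto {h = h} _ R↦x₀ h≡x₀ z∈R =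
    trans (contract-R z∈R) (trans R↦x₀ (cong just (trans (ι-cong (sym h≡x₀) _ _) (ι-enum h))))

  realise-edge : ∀ h h′ → Adj H h h′ →
    ∃₂ λ u v → contract u ≡ just h × contract v ≡ just h′ × Adj G u v
  realise-edge h h′ hh′ with H-adj⁻ hh′
  ... | inj₁ uv = enum K h , enum K h′ , contract-enum h , contract-enum h′ , uv
  ... | inj₂ (h∈N , h′∈N , h≢h′) with R-image-nonempty (any? (_∈? N)) h∈N
  ...   | x₀ , x₀∈N , R↦x₀ with enum K h ≟ᶠ x₀ | enum K h′ ≟ᶠ x₀
  ...     | yes h≡x₀ | _ with proj₂ (∈-nbhd⁻ G R h′∈N)
  ...       | z , z∈R , zh′ =
    z , enum K h′ , contract-R-onto x₀∈N R↦x₀ h≡x₀ z∈R , contract-enum h′ , zh′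
  realise-edge h h′ hh′ | inj₂ (h∈N , _ , _) | x₀ , x₀∈N , R↦x₀ | no _ | yes h′≡x₀
    with proj₂ (∈-nbhd⁻ G R h∈N)
  ...       | z , z∈R , zh =
    enum K h , z , contract-enum h , contract-R-onto x₀∈N R↦x₀ h′≡x₀ z∈R , Adj-sym G zh
  realise-edge h h′ hh′ | inj₂ (h∈N , h′∈N , h≢h′) | x₀ , x₀∈N , _ | no h≢x₀ | no h′≢x₀ =
    ⊥-elim (N-pair h∈N h′∈N x₀∈N (h≢h′ ∘ enum-injective K) h≢x₀ h′≢x₀)

  φ : MinorMap G H
  φ = record
    { f = contract
    ; surj = λ h → enum K h , contract-enum h
    ; branch-conn = λ h u u′ u∈ u′∈ →
        walk-to-enum (∈-decSubset⁻ (λ u → contract u ≟M just h) u∈)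
          ++ʷ walk-reverse (walk-to-enum (∈-decSubset⁻ (λ u → contract u ≟M just h) u′∈))
    ; edges = realise-edge
    }

  smaller : m < n G
  smaller = subst (m <_) (∣⊤∣≡n (n G))
    (p⊂q⇒∣p∣<∣q∣ ((λ _ → ∈⊤) , r₀ , ∈⊤ , λ r₀∈K → x∈∁p⇒x∉p r₀∈K r₀∈R))

  _↦_ : V G → Subset m → Set
  v ↦ C = ∃ λ h → h ∈ C × contract v ≡ just h

  _↦?_ : ∀ v C → Dec (v ↦ C)
  v ↦? C = any? λ h → (h ∈? C) ×-dec (contract v ≟M just h)

  ↦-∈ : ∀ {v h C} → v ↦ C → contract v ≡ just h → h ∈ C
  ↦-∈ {C = C} (h′ , h′∈C , cv) cv′ = subst (_∈ C) (just-injective (trans (sym cv) cv′)) h′∈C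

  ι-↦ : ∀ {v C} v∉R → ι v v∉R ∈ C → v ↦ C
  ι-↦ v∉R ιv∈C = _ , ιv∈C , contract-∉R v∉R

  ↦-ι : ∀ {v C} v∉R → v ↦ C → ι v v∉R ∈ C
  ↦-ι {v} v∉R v↦C = ↦-∈ {v} v↦C (contract-∉R v∉R)

  N↦ : Subset m → Set
  N↦ C = ∀ a → a ∈ N → a ↦ C

  N↦? : ∀ C → Dec (N↦ C)
  N↦? C = all? λ a → (a ∈? N) →-dec (a ↦? C)

  -- N has at most two vertices and they are adjacent in H, so a covering of H
  -- contains all of them in one part.
  N↦-some : ∀ {C₁ C₂ C₃} → Covers3 H C₁ C₂ C₃ → N↦ C₁ ⊎ N↦ C₂ ⊎ N↦ C₃
  N↦-some (covV , covE) with any? (_∈? N)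
  ... | no N≡∅ = inj₁ (λ a a∈N → ⊥-elim (N≡∅ (a , a∈N)))
  ... | yes (x , x∈N) with any? (λ y → (y ∈? N) ×-dec ¬? (y ≟ᶠ x))
  ...   | yes (y , y∈N , y≢x) =
    ⊎₃-map {P = λ C → ι x (N∉R x∈N) ∈ C × ι y (N∉R y∈N) ∈ C} {Q = N↦}
           (λ (ιx∈C , ιy∈C) → N↦-pair ιx∈C ιy∈C) (covE _ _ (H-adj-N x∈N y∈N (y≢x ∘ sym)))
    where
    N↦-pair : ∀ {C} → ι x (N∉R x∈N) ∈ C → ι y (N∉R y∈N) ∈ C → N↦ C
    N↦-pair {C} ιx∈C ιy∈C a a∈N with a ≟ᶠ x | a ≟ᶠ y
    ... | yes refl | _ = ι-↦ (N∉R a∈N) (subst (_∈ C) (ι-cong refl _ _) ιx∈C)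
    ... | no _ | yes refl = ι-↦ (N∉R a∈N) (subst (_∈ C) (ι-cong refl _ _) ιy∈C)
    ... | no a≢x | no a≢y = ⊥-elim (N-pair a∈N x∈N y∈N a≢x a≢y (y≢x ∘ sym))
  ...   | no ¬y = ⊎₃-map {P = ι x (N∉R x∈N) ∈_} {Q = N↦} N↦-single (covV _)
    where
    N↦-single : ∀ {C} → ι x (N∉R x∈N) ∈ C → N↦ C
    N↦-single {C} ιx∈C a a∈N with a ≟ᶠ x
    ... | yes refl = ι-↦ (N∉R a∈N) (subst (_∈ C) (ι-cong refl _ _) ιx∈C)
    ... | no a≢x = ⊥-elim (¬y (a , a∈N , a≢x))

  N↦-other : ∀ {C D} → IsSep H C D → ¬ N↦ C → N↦ D
  N↦-other {C} {D} sep ¬N↦C with N↦-some (sep-covers {H} {C} {D} sep)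
  ... | inj₁ N↦C = ⊥-elim (¬N↦C N↦C)
  ... | inj₂ (inj₁ N↦D) = N↦D
  ... | inj₂ (inj₂ N↦C) = ⊥-elim (¬N↦C N↦C)

  -- R goes to the first side exactly when N does.
  PullA : Subset m → V G → Set
  PullA C v = (v ∈ R × N↦ C) ⊎ (v ∉ R × v ↦ C)

  PullB : Subset m → Subset m → V G → Set
  PullB C D v = (v ∈ R × ¬ N↦ C) ⊎ (v ∉ R × v ↦ D)

  PullA? : ∀ C v → Dec (PullA C v)
  PullA? C v = (v ∈? R) ×-dec N↦? C ⊎-dec ¬? (v ∈? R) ×-dec v ↦? C

  PullB? : ∀ C D v → Dec (PullB C D v)
  PullB? C D v = (v ∈? R) ×-dec ¬? (N↦? C) ⊎-dec ¬? (v ∈? R) ×-dec v ↦? D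

  pullA : Subset m → VSet G
  pullA C = tabulate (λ v → ⌊ PullA? C v ⌋)

  pullB : Subset m → Subset m → VSet G
  pullB C D = tabulate (λ v → ⌊ PullB? C D v ⌋)

  ∈-pullA⁻ : ∀ {C v} → v ∈ pullA C → PullA C v
  ∈-pullA⁻ {C} = ∈-decSubset⁻ (PullA? C)

  ∈-pullA⁺ : ∀ {C v} → PullA C v → v ∈ pullA C
  ∈-pullA⁺ {C} = ∈-decSubset⁺ (PullA? C)

  ∈-pullB⁻ : ∀ {C D v} → v ∈ pullB C D → PullB C D v
  ∈-pullB⁻ {C} {D} = ∈-decSubset⁻ (PullB? C D)

  ∈-pullB⁺ : ∀ {C D v} → PullB C D v → v ∈ pullB C D
  ∈-pullB⁺ {C} {D} = ∈-decSubset⁺ (PullB? C D)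

  ι-pullA : ∀ {C v} v∉R → ι v v∉R ∈ C → v ∈ pullA C
  ι-pullA v∉R ιv∈C = ∈-pullA⁺ (inj₂ (v∉R , ι-↦ v∉R ιv∈C))

  ι-pullB : ∀ {C D v} v∉R → ι v v∉R ∈ D → v ∈ pullB C D
  ι-pullB v∉R ιv∈D = ∈-pullB⁺ (inj₂ (v∉R , ι-↦ v∉R ιv∈D))

  R∪N⊆pullA : ∀ {C v} → N↦ C → v ∈ R ∪ N → v ∈ pullA C
  R∪N⊆pullA {C} {v} N↦C v∈R∪N with x∈p∪q⁻ R N v∈R∪N
  ... | inj₁ v∈R = ∈-pullA⁺ (inj₁ (v∈R , N↦C))
  ... | inj₂ v∈N = ∈-pullA⁺ (inj₂ (N∉R v∈N , N↦C v v∈N))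

  R-edge : ∀ {a b} → a ∈ R → Adj G a b → a ∈ R ∪ N × b ∈ R ∪ N
  R-edge {a} {b} a∈R ab with b ∈? R
  ... | yes b∈R = p⊆p∪q N a∈R , p⊆p∪q N b∈R
  ... | no b∉R = p⊆p∪q N a∈R , q⊆p∪q R N (∈-nbhd⁺ G R (b∉R , a , a∈R , ab))

  pull-isSep : ∀ {C D} → IsSep H C D → IsSep G (pullA C) (pullB C D)
  pull-isSep {C} {D} sep = cover , no-edge
    where
    cover : ∀ v → v ∈ pullA C ⊎ v ∈ pullB C D
    cover v with v ∈? R
    ... | yes v∈R = Sum.map (λ N↦C → ∈-pullA⁺ (inj₁ (v∈R , N↦C)))
                            (λ ¬N↦C → ∈-pullB⁺ (inj₁ (v∈R , ¬N↦C))) (toSum (N↦? C))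
    ... | no v∉R = Sum.map (ι-pullA v∉R) (ι-pullB v∉R) (proj₁ sep (ι v v∉R))
    no-edge : ∀ a b → a ∈ pullA C → a ∉ pullB C D → b ∈ pullB C D → b ∉ pullA C →
              ¬ Adj G a b
    no-edge a b a∈A a∉B b∈B b∉A ab with ∈-pullA⁻ a∈A | ∈-pullB⁻ b∈B
    ... | inj₁ (_ , N↦C) | inj₁ (_ , ¬N↦C) = ¬N↦C N↦C
    ... | inj₁ (a∈R , N↦C) | inj₂ (b∉R , _) =
      b∉A (R∪N⊆pullA N↦C (proj₂ (R-edge a∈R ab)))
    ... | inj₂ (a∉R , _) | inj₁ (b∈R , ¬N↦C) =
      a∉B (ι-pullB a∉R (↦-ι a∉R (N↦-other sep ¬N↦C a (∈-nbhd⁺ G R (a∉R , b , b∈R , Adj-sym G ab)))))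
    ... | inj₂ (a∉R , a↦C) | inj₂ (b∉R , b↦D) =
      proj₂ sep _ _ (↦-ι a∉R a↦C) (a∉B ∘ ι-pullB a∉R) (↦-ι b∉R b↦D) (b∉A ∘ ι-pullA b∉R)
        (H-adj-G a∉R b∉R ab)

  pull-order-≤ : ∀ C D → order G (pullA C) (pullB C D) ≤ order H C D
  pull-order-≤ C D = ∣∣-mono-injection _ _ (λ v v∈ → ι v (∩∉R v∈)) ι∈C∩D
                       (λ v w v∈ w∈ → ι-injective _ _)
    where
    ∩∉R : ∀ {v} → v ∈ pullA C ∩ pullB C D → v ∉ R
    ∩∉R v∈ v∈R with x∈p∩q⁻ _ _ v∈
    ... | v∈A , v∈B with ∈-pullA⁻ v∈A | ∈-pullB⁻ v∈B
    ... | inj₁ (_ , N↦C) | inj₁ (_ , ¬N↦C) = ¬N↦C N↦C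
    ... | inj₂ (v∉R , _) | _ = v∉R v∈R
    ... | _ | inj₂ (v∉R , _) = v∉R v∈R
    ι∈C∩D : ∀ v v∈ → ι v (∩∉R v∈) ∈ C ∩ D
    ι∈C∩D v v∈ with x∈p∩q⁻ _ _ v∈
    ... | v∈A , v∈B with ∈-pullA⁻ v∈A | ∈-pullB⁻ v∈B
    ... | inj₁ (v∈R , _) | _ = ⊥-elim (∩∉R v∈ v∈R)
    ... | inj₂ _ | inj₁ (v∈R , _) = ⊥-elim (∩∉R v∈ v∈R)
    ... | inj₂ (_ , v↦C) | inj₂ (_ , v↦D) = x∈p∩q⁺ (↦-ι _ v↦C , ↦-ι _ v↦D)

  imgSet-pull : ∀ {S C} → (∀ {v} → v ∈ S → v ∈ R → N↦ C) → (∀ {v} → v ∈ S → v ∉ R → v ↦ C) →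
                (∀ h → enum K h ↦ C → enum K h ∈ S) → imgSet φ S ≡ C
  imgSet-pull {S} {C} R-case K-case enum∈S = ⊆-antisym′ img⊆C C⊆img
    where
    img⊆C : ∀ h → h ∈ imgSet φ S → h ∈ C
    img⊆C h h∈ with ∈-imgSet⁻ φ h∈
    ... | u , u∈S , cu = by-cases (u ∈? R)
      where
      by-cases : Dec (u ∈ R) → h ∈ C
      by-cases (no u∉R) = ↦-∈ {u} (K-case u∈S u∉R) cu
      by-cases (yes u∈R) with R-image-just (any? (_∈? N)) (trans (sym (contract-R u∈R)) cu)
      ... | x , x∈N , ιx≡h =
        ↦-∈ {x} (R-case u∈S u∈R x x∈N) (trans (contract-∉R (N∉R x∈N)) (cong just ιx≡h))
    C⊆img : ∀ h → h ∈ C → h ∈ imgSet φ S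
    C⊆img h h∈C = ∈-imgSet⁺ φ (enum∈S h (_ , h∈C , contract-enum h)) (contract-enum h)

  pull-imgA : ∀ C → imgSet φ (pullA C) ≡ C
  pull-imgA C = imgSet-pull R-case K-case (λ h h↦C → ∈-pullA⁺ (inj₂ (enum∉R h , h↦C)))
    where
    R-case : ∀ {v} → v ∈ pullA C → v ∈ R → N↦ C
    R-case v∈A v∈R with ∈-pullA⁻ v∈A
    ... | inj₁ (_ , N↦C) = N↦C
    ... | inj₂ (v∉R , _) = ⊥-elim (v∉R v∈R)
    K-case : ∀ {v} → v ∈ pullA C → v ∉ R → v ↦ C
    K-case v∈A v∉R with ∈-pullA⁻ v∈A
    ... | inj₁ (v∈R , _) = ⊥-elim (v∉R v∈R)
    ... | inj₂ (_ , v↦C) = v↦C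

  pull-imgB : ∀ {C D} → IsSep H C D → imgSet φ (pullB C D) ≡ D
  pull-imgB {C} {D} sep =
    imgSet-pull R-case K-case (λ h h↦D → ∈-pullB⁺ (inj₂ (enum∉R h , h↦D)))
    where
    R-case : ∀ {v} → v ∈ pullB C D → v ∈ R → N↦ D
    R-case v∈B v∈R with ∈-pullB⁻ v∈B
    ... | inj₁ (_ , ¬N↦C) = N↦-other sep ¬N↦C
    ... | inj₂ (v∉R , _) = ⊥-elim (v∉R v∈R)
    K-case : ∀ {v} → v ∈ pullB C D → v ∉ R → v ↦ D
    K-case v∈B v∉R with ∈-pullB⁻ v∈B
    ... | inj₁ (v∈R , _) = ⊥-elim (v∉R v∈R)
    ... | inj₂ (_ , v↦D) = v↦D

  ι-imgSet : ∀ {A v} → v ∈ A → ∀ v∉R → ι v v∉R ∈ imgSet φ A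
  ι-imgSet v∈A v∉R = ∈-imgSet⁺ φ v∈A (contract-∉R v∉R)

  R-side-edge : ∀ {a b} → Adj G a b → a ∈ R ⊎ b ∈ R → a ∈ R ∪ N × b ∈ R ∪ N
  R-side-edge ab (inj₁ a∈R) = R-edge a∈R ab
  R-side-edge ab (inj₂ b∈R) = Product.swap (R-edge b∈R (Adj-sym G ab))

  covers-with-R∪N : ∀ {A B} → IsSep G A B →
    Covers3 G A (pullB (imgSet φ A) (imgSet φ B)) (R ∪ N)
  covers-with-R∪N {A} {B} sep = vertices , edges′
    where
    vertices : ∀ v → v ∈ A ⊎ v ∈ pullB _ _ ⊎ v ∈ R ∪ N
    vertices v with v ∈? R
    ... | yes v∈R = inj₂ (inj₂ (p⊆p∪q N v∈R))
    ... | no v∉R = Sum.map₂ (λ v∈B → inj₁ (ι-pullB v∉R (ι-imgSet v∈B v∉R))) (proj₁ sep v)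
    edges′ : ∀ a b → Adj G a b →
      (a ∈ A × b ∈ A) ⊎ (a ∈ pullB _ _ × b ∈ pullB _ _) ⊎ (a ∈ R ∪ N × b ∈ R ∪ N)
    edges′ a b ab with a ∈? R | b ∈? R
    ... | yes a∈R | _ = inj₂ (inj₂ (R-side-edge ab (inj₁ a∈R)))
    ... | no _ | yes b∈R = inj₂ (inj₂ (R-side-edge ab (inj₂ b∈R)))
    ... | no a∉R | no b∉R =
      Sum.map₂ (λ (a∈B , b∈B) → inj₁ ( ι-pullB a∉R (ι-imgSet a∈B a∉R)
                                     , ι-pullB b∉R (ι-imgSet b∈B b∉R)))
               (sep-edge {G} {A} {B} sep ab)

  -- The reverse orientation would form, with (A,B) and (R ∪ N, V ∖ R), a covering triple.
  pull-img-∈ : ∀ {A B} → τ A B → τ (pullA (imgSet φ A)) (pullB (imgSet φ A) (imgSet φ B))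
  pull-img-∈ {A} {B} t = orientation (total _ _ (pull-isSep (imgSet-isSep φ sep)) order<)
    where
    open IsTangle T
    sep : IsSep G A B
    sep = proj₁ (members A B t)
    order< : order G (pullA (imgSet φ A)) (pullB (imgSet φ A) (imgSet φ B)) < k
    order< = ℕ.≤-<-trans (pull-order-≤ _ _)
               (ℕ.≤-<-trans (imgSet-order-≤ φ sep) (proj₂ (members A B t)))
    orientation : τ (pullA _) (pullB _ _) ⊎ τ (pullB _ _) (pullA _) → τ (pullA _) (pullB _ _)
    orientation (inj₁ t′) = t′
    orientation (inj₂ t′) = ⊥-elim (no-cover _ _ _ _ _ _ t t′ τ-away (covers-with-R∪N sep))

  R∪N-edge-pullA : ∀ {a b C} → Adj G a b → a ∈ R ⊎ b ∈ R → N↦ C → a ∈ pullA C × b ∈ pullA C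
  R∪N-edge-pullA ab R∋ N↦C = Product.map (R∪N⊆pullA N↦C) (R∪N⊆pullA N↦C) (R-side-edge ab R∋)

  pull-covers : ∀ {C₁ C₂ C₃} → Covers3 H C₁ C₂ C₃ →
                Covers3 G (pullA C₁) (pullA C₂) (pullA C₃)
  pull-covers {C₁} {C₂} {C₃} cov@(covV , covE) = vertices , edges′
    where
    N-part : N↦ C₁ ⊎ N↦ C₂ ⊎ N↦ C₃
    N-part = N↦-some cov
    vertices : ∀ v → v ∈ pullA C₁ ⊎ v ∈ pullA C₂ ⊎ v ∈ pullA C₃
    vertices v with v ∈? R
    ... | yes v∈R = ⊎₃-map {P = N↦} (λ N↦C → R∪N⊆pullA N↦C (p⊆p∪q N v∈R)) N-part
    ... | no v∉R = ⊎₃-map {P = ι v v∉R ∈_} (ι-pullA v∉R) (covV (ι v v∉R))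
    edges′ : ∀ a b → Adj G a b →
      (a ∈ pullA C₁ × b ∈ pullA C₁) ⊎ (a ∈ pullA C₂ × b ∈ pullA C₂) ⊎ (a ∈ pullA C₃ × b ∈ pullA C₃)
    edges′ a b ab with a ∈? R | b ∈? R
    ... | yes a∈R | _ = ⊎₃-map {P = N↦} (R∪N-edge-pullA ab (inj₁ a∈R)) N-part
    ... | no _ | yes b∈R = ⊎₃-map {P = N↦} (R∪N-edge-pullA ab (inj₂ b∈R)) N-part
    ... | no a∉R | no b∉R =
      ⊎₃-map {P = λ C → ι a a∉R ∈ C × ι b b∉R ∈ C}
             (Product.map (ι-pullA a∉R) (ι-pullA b∉R)) (covE _ _ (H-adj-G a∉R b∉R ab))

  pullback : Pullback φ τ
  pullback = record
    { pullA = pullA ; pullB = pullB ; isSep = pull-isSep ; order-≤ = pull-order-≤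
    ; imgA = pull-imgA ; imgB = pull-imgB ; pull-img-∈ = pull-img-∈ ; pull-covers = pull-covers }

-- Otherwise (V, V) has order < k + 1 and three copies of it cover G.
IsTangle⇒k<n : ∀ {G τ k} → IsTangle G (suc k) τ → k < n G
IsTangle⇒k<n {G} {τ} {k} T with k <? n G
... | yes k<n = k<n
... | no k≮n = ⊥-elim (no-cover ⊤ ⊤ ⊤ ⊤ ⊤ ⊤ t t t (sep-covers {G} {⊤} {⊤} sep))
  where
  open IsTangle T
  sep : IsSep G ⊤ ⊤
  sep = (λ _ → inj₁ ∈⊤) , λ _ _ _ u∉⊤ _ _ → ⊥-elim (u∉⊤ ∈⊤)
  order≤k : order G ⊤ ⊤ ≤ k
  order≤k = ℕ.≤-trans (∣p∩q∣≤∣p∣ (⊤ {n G}) ⊤) (ℕ.≤-trans (ℕ.≤-reflexive (∣⊤∣≡n (n G))) (ℕ.≮⇒≥ k≮n))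
  t : τ ⊤ ⊤
  t = [ id , id ] (total ⊤ ⊤ sep (s≤s order≤k))

ConnectedTangleMinor : (G : Graph) → OrientedSepSet G → Set
ConnectedTangleMinor G τ =
  Σ Graph (λ H → Σ (MinorMap G H) (λ φ → KConnected 3 H × IsTangle H 4 (imgτ φ τ)))

ConnectedTangleMinor-id : ∀ {G τ} → KConnected 3 G → IsTangle G 4 τ → ConnectedTangleMinor G τ
ConnectedTangleMinor-id {G} {τ} conn T = G , idMinor G , conn , IsTangle-resp-⇔ T τ⇒ ⇒τ
  where
  τ⇒ : ∀ A B → τ A B → imgτ (idMinor G) τ A B
  τ⇒ A B t = A , B , t , imgSet-id G A , imgSet-id G B
  ⇒τ : ∀ A B → imgτ (idMinor G) τ A B → τ A B
  ⇒τ _ _ (A , B , t , refl , refl) = subst₂ τ (sym (imgSet-id G A)) (sym (imgSet-id G B)) t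

ConnectedTangleMinor-∘ : ∀ {G H τ} (φ : MinorMap G H) →
  ConnectedTangleMinor H (imgτ φ τ) → ConnectedTangleMinor G τ
ConnectedTangleMinor-∘ {τ = τ} φ (K , ψ , conn , T) =
  K , φ ∘ᴹ ψ , conn , IsTangle-resp-⇔ T (imgτ-∘⁺ φ ψ τ) (imgτ-∘⁻ φ ψ τ)

connectedTangleMinor : ∀ G τ → Acc _<_ (n G) → IsTangle G 4 τ → ConnectedTangleMinor G τ
connectedTangleMinor G τ (acc smaller-acc) T
  with KConnected-or-Separable 3 G (IsTangle⇒k<n T)
... | inj₁ conn = ConnectedTangleMinor-id conn T
... | inj₂ sep = ConnectedTangleMinor-∘ φ
      (connectedTangleMinor H (imgτ φ τ) (smaller-acc smaller) (imgτ-isTangle T pullback))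
  where open Contraction T (smallSide T sep)

lemma3p14 : (G : Graph) (τ : OrientedSepSet G) → IsTangle G 4 τ →
    Σ Graph (λ H → Σ (MinorMap G H) (λ φ →
      KConnected 3 H × IsTangle H 4 (imgτ φ τ)))
lemma3p14 G τ = connectedTangleMinor G τ (<-wellFounded (n G))
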